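{- Let $F$ and $F'$ be CNF formulae sharing no variables, with $F'$ satisfiable, and let $c \in F$. Then $c$ is superredundant in $F$ if and only if $c$ is superredundant in $F \cup F'$.
   Context: A CNF formula is a finite set of clauses; a clause is a finite set of literals, read as their disjunction. Tautological clauses are not allowed. Resolution: from clauses $c_1 \vee l$ and $c_2 \vee \neg l$ derive $c_1 \vee c_2$; two clauses whose resolvent would be a tautology are considered not to resolve. The resolution closure $\mathrm{ResCn}(F)$ is the set of all clauses obtainable from $F$ by zero or more resolution steps. A clause $c \in F$ is superredundant in $F$ if $\mathrm{ResCn}(F) \setminus \{c\} \models c$. -}

module Defs where

open import Data.Nat using (ℕ)
open import Data.Bool using (Bool; not)
open import Data.List using (List; _++_)
open import Data.List.Relation.Unary.Any using (Any)
open import Data.List.Membership.Propositional using (_∈_)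
open import Data.Product using (_×_; ∃)
open import Data.Sum using (_⊎_)
open import Relation.Nullary using (¬_)
open import Relation.Binary.PropositionalEquality using (_≡_; _≢_)
open import Function.Bundles using (_⇔_)

-- Variables are natural numbers; a literal is a variable with a polarity
-- (sign true = positive literal x, sign false = negative literal ¬x).
record Literal : Set where
  constructor lit
  field
    var  : ℕ
    sign : Bool
open Literal public

neg : Literal → Literal
neg (lit v s) = lit v (not s)

-- A clause is a finite set of literals, represented by a list;
-- only its member set matters (see _≋_).
Clause : Set
Clause = List Literal

CNF : Set
CNF = List Clause

_≋_ : Clause → Clause → Set
c ≋ d = ∀ x → (x ∈ c) ⇔ (x ∈ d)

Tautology : Clause → Set
Tautology c = ∃ λ x → (x ∈ c) × (neg x ∈ c)

WellFormed : CNF → Set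
WellFormed F = ∀ c → c ∈ F → ¬ Tautology c

IsResolvent : Clause → Clause → Literal → Clause → Set
IsResolvent d₁ d₂ l r =
  (l ∈ d₁) × (neg l ∈ d₂) ×
  (∀ x → (x ∈ r) ⇔ (((x ∈ d₁) × (x ≢ l)) ⊎ ((x ∈ d₂) × (x ≢ neg l))))

-- Resolution closure ResCn(F), as a predicate on clauses (up to set equality).
-- Clauses whose resolvent would be a tautology do not resolve.
data ResCn (F : CNF) : Clause → Set where
  base : ∀ {c} → Any (c ≋_) F → ResCn F c
  step : ∀ {d₁ d₂ r} (l : Literal) →
         ResCn F d₁ → ResCn F d₂ →
         IsResolvent d₁ d₂ l r → ¬ Tautology r →
         ResCn F r

Assignment : Set
Assignment = ℕ → Bool

_⊨ˡ_ : Assignment → Literal → Set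
α ⊨ˡ l = α (var l) ≡ sign l

_⊨_ : Assignment → Clause → Set
α ⊨ c = Any (α ⊨ˡ_) c

Satisfiable : CNF → Set
Satisfiable F = ∃ λ (α : Assignment) → ∀ d → d ∈ F → α ⊨ d

Superredundant : CNF → Clause → Set
Superredundant F c =
  ∀ (α : Assignment) → (∀ d → ResCn F d → ¬ (d ≋ c) → α ⊨ d) → α ⊨ c

Disjoint : CNF → CNF → Set
Disjoint F F' = ∀ d d' l l' → d ∈ F → d' ∈ F' → l ∈ d → l' ∈ d' → var l ≢ var l'

{-# OPTIONS --safe #-}
module Submission where

-- Adding F' only weakens the hypothesis ResCn(F) ∖ {c} of superredundancy, so that
-- direction is free. Conversely, since F and F' share no variables, every clause of
-- ResCn(F ∪ F') lies in ResCn(F) or in ResCn(F'): a resolution step needs a variable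
-- common to both premises. Given α satisfying ResCn(F) ∖ {c}, glue it with a model α'
-- of F' (α' on the variables of F', α elsewhere); the glued assignment satisfies
-- ResCn(F ∪ F') ∖ {c} (ResCn(F') by soundness of resolution) and agrees with α on c.

open import Defs
open import Data.Nat using (ℕ) renaming (_≟_ to _≟ℕ_)
open import Data.Bool using () renaming (_≟_ to _≟𝔹_)
open import Data.Bool.Properties using (not-¬)
open import Data.List using (_++_)
open import Data.List.Relation.Unary.Any using (Any; any?)
open import Data.List.Relation.Unary.Any.Properties using (++⁺ˡ; ++⁻)
open import Data.List.Membership.Propositional using (_∈_; find; lose)
open import Data.Product using (_,_)
open import Data.Sum using (_⊎_; inj₁; inj₂)
open import Relation.Nullary using (¬_; Dec; yes; no; contradiction)
open import Relation.Binary.PropositionalEquality using (_≡_; _≢_; refl; sym; trans)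
open import Function.Bundles using (_⇔_; mk⇔; Equivalence)

Occurs : CNF → ℕ → Set
Occurs F v = Any (Any (λ l → var l ≡ v)) F

occurs? : ∀ F v → Dec (Occurs F v)
occurs? F v = any? (any? (λ l → var l ≟ℕ v)) F

disjoint⇒¬occurs-both : ∀ {F F'} → Disjoint F F' → ∀ {v} → Occurs F v → ¬ Occurs F' v
disjoint⇒¬occurs-both D o o'
  with d , d∈F , l-in-d ← find o | d' , d'∈F' , l'-in-d' ← find o'
  with l , l∈d , refl ← find l-in-d | l' , l'∈d' , l'≡ ← find l'-in-d'
  = D d d' l l' d∈F d'∈F' l∈d l'∈d' (sym l'≡)

resCn-occurs : ∀ {F d} → ResCn F d → ∀ {x} → x ∈ d → Occurs F (var x)
resCn-occurs (base d-in-F) {x} x∈d with e , e∈F , d≋e ← find d-in-F =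
  lose e∈F (lose (Equivalence.to (d≋e x) x∈d) refl)
resCn-occurs (step _ r₁ r₂ (_ , _ , resolvent) _) {x} x∈d
  with Equivalence.to (resolvent x) x∈d
... | inj₁ (x∈d₁ , _) = resCn-occurs r₁ x∈d₁
... | inj₂ (x∈d₂ , _) = resCn-occurs r₂ x∈d₂

resCn-++⁺ˡ : ∀ {F d} F' → ResCn F d → ResCn (F ++ F') d
resCn-++⁺ˡ F' (base d-in-F)        = base (++⁺ˡ d-in-F)
resCn-++⁺ˡ F' (step l r₁ r₂ res ¬t) = step l (resCn-++⁺ˡ F' r₁) (resCn-++⁺ˡ F' r₂) res ¬t

resCn-++⁻ : ∀ {F F'} → Disjoint F F' → ∀ {d} →
            ResCn (F ++ F') d → ResCn F d ⊎ ResCn F' d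
resCn-++⁻ {F} D (base d-in-FF') with ++⁻ F d-in-FF'
... | inj₁ d-in-F  = inj₁ (base d-in-F)
... | inj₂ d-in-F' = inj₂ (base d-in-F')
resCn-++⁻ D (step l r₁ r₂ res@(l∈d₁ , ¬l∈d₂ , _) ¬t)
  with resCn-++⁻ D r₁ | resCn-++⁻ D r₂
... | inj₁ r₁ | inj₁ r₂ = inj₁ (step l r₁ r₂ res ¬t)
... | inj₂ r₁ | inj₂ r₂ = inj₂ (step l r₁ r₂ res ¬t)
... | inj₁ r₁ | inj₂ r₂ =
  contradiction (resCn-occurs r₂ ¬l∈d₂) (disjoint⇒¬occurs-both D (resCn-occurs r₁ l∈d₁))
... | inj₂ r₁ | inj₁ r₂ =
  contradiction (resCn-occurs r₁ l∈d₁) (disjoint⇒¬occurs-both D (resCn-occurs r₂ ¬l∈d₂))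

⊨ˡ-neg : ∀ {α l} → α ⊨ˡ l → ¬ (α ⊨ˡ neg l)
⊨ˡ-neg {l = lit _ _} αl α¬l = not-¬ αl α¬l

resCn-sound : ∀ {F α} → (∀ d → d ∈ F → α ⊨ d) → ∀ {d} → ResCn F d → α ⊨ d
resCn-sound ⊨F (base d-in-F)
  with e , e∈F , d≋e ← find d-in-F
  with x , x∈e , αx ← find (⊨F e e∈F)
  = lose (Equivalence.from (d≋e x) x∈e) αx
resCn-sound {α = α} ⊨F (step l r₁ r₂ (_ , _ , resolvent) _) with α (var l) ≟𝔹 sign l
... | yes αl with x , x∈d₂ , αx ← find (resCn-sound ⊨F r₂) =
  lose (Equivalence.from (resolvent x) (inj₂ (x∈d₂ , x≢¬l))) αx
  where
  x≢¬l : x ≢ neg l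
  x≢¬l refl = ⊨ˡ-neg {α} {l} αl αx
... | no ¬αl with x , x∈d₁ , αx ← find (resCn-sound ⊨F r₁) =
  lose (Equivalence.from (resolvent x) (inj₁ (x∈d₁ , x≢l))) αx
  where
  x≢l : x ≢ l
  x≢l refl = ¬αl αx

⊨-agree : ∀ {α β d} → (∀ {x} → x ∈ d → α (var x) ≡ β (var x)) → α ⊨ d → β ⊨ d
⊨-agree agree α⊨d with x , x∈d , αx ← find α⊨d = lose x∈d (trans (sym (agree x∈d)) αx)

superredundant-++⁺ : ∀ {F c} F' → Superredundant F c → Superredundant (F ++ F') c
superredundant-++⁺ F' S α ⊨rest = S α (λ d r d≉c → ⊨rest d (resCn-++⁺ˡ F' r) d≉c)

glue : CNF → Assignment → Assignment → Assignment
glue F' α' α v with occurs? F' v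
... | yes _ = α' v
... | no  _ = α v

glue-occurs : ∀ F' α' α {v} → Occurs F' v → glue F' α' α v ≡ α' v
glue-occurs F' α' α {v} o with occurs? F' v
... | yes _ = refl
... | no ¬o = contradiction o ¬o

glue-¬occurs : ∀ F' α' α {v} → ¬ Occurs F' v → glue F' α' α v ≡ α v
glue-¬occurs F' α' α {v} ¬o with occurs? F' v
... | yes o = contradiction o ¬o
... | no  _ = refl

superredundant-++⁻ : ∀ {F F' c} → Disjoint F F' → Satisfiable F' →
                     (∀ {x} → x ∈ c → ¬ Occurs F' (var x)) →
                     Superredundant (F ++ F') c → Superredundant F c
superredundant-++⁻ {F} {F'} {c} D (α' , α'⊨F') c-off-F' S α ⊨rest =
  ⊨-agree (λ x∈c → glue-¬occurs F' α' α (c-off-F' x∈c)) (S β ⊨rest-β)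
  where
  β : Assignment
  β = glue F' α' α

  ⊨rest-β : ∀ d → ResCn (F ++ F') d → ¬ (d ≋ c) → β ⊨ d
  ⊨rest-β d r d≉c with resCn-++⁻ D r
  ... | inj₁ r = ⊨-agree
    (λ x∈d → sym (glue-¬occurs F' α' α (disjoint⇒¬occurs-both D (resCn-occurs r x∈d))))
    (⊨rest d r d≉c)
  ... | inj₂ r = ⊨-agree
    (λ x∈d → sym (glue-occurs F' α' α (resCn-occurs r x∈d)))
    (resCn-sound α'⊨F' r)

lemma13 : (F F' : CNF) (c : Clause) →
    WellFormed F → WellFormed F' →
    Disjoint F F' → Satisfiable F' → c ∈ F →
    Superredundant F c ⇔ Superredundant (F ++ F') c
lemma13 F F' c _ _ D sat c∈F = mk⇔ (superredundant-++⁺ F') (superredundant-++⁻ D sat c-off-F')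
  where
  c-off-F' : ∀ {x} → x ∈ c → ¬ Occurs F' (var x)
  c-off-F' x∈c = disjoint⇒¬occurs-both D (lose c∈F (lose x∈c refl))
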